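{- Let $q\ge 2$ and $n\ge 1$ be integers, and let $S=(s_i)$ be a special orientable sequence of order $n$ over $\mathbb{Z}_q$ with period $m$. Let $h$ be the additive order of $w_q(S)$ in $\mathbb{Z}_q$. Then there are $q/h$ sequences $T_1,\dots,T_{q/h}$, each a special orientable sequence of order $n+1$ with period $hm$, which are translates of one another and pairwise special-o-disjoint, such that $D^{ -1}(S)$ consists exactly of the $h$ shifts $(t_{i+km})_i$, $0\le k\le h-1$, of each $T_\ell=(t_i)$.
   Context: Sequences are periodic with entries in $\mathbb{Z}_q$; the period means the least period. For $S=(s_i)$ of period $m$, $\mathbf{s}_n(i)=(s_i,\dots,s_{i+n-1})$ and $w_q(S)=\sum_{i=0}^{m-1}s_i \bmod q$. For $\mathbf{u}=(u_0,\dots,u_{n-1})$, $\mathbf{u}^R=(u_{n-1},\dots,u_0)$ and $-\mathbf{u}=(-u_0,\dots,-u_{n-1})$. $S$ is an $n$-window sequence if $\mathbf{s}_n(i)=\mathbf{s}_n(j)$ implies $i\equiv j\pmod m$. $S$ is a special orientable sequence of order $n$ if it is an $n$-window sequence with $\mathbf{s}_n(i)\neq\mathbf{s}_n(j)^R$ and $\mathbf{s}_n(i)\neq-\mathbf{s}_n(j)^R$ for all $i,j$. Two $n$-window sequences $S,S'$ are special-o-disjoint if for all $i,j$: $\mathbf{s}_n(i)\neq\mathbf{s}'_n(j)$, $\mathbf{s}_n(i)\neq\mathbf{s}'_n(j)^R$ and $\mathbf{s}_n(i)\neq-\mathbf{s}'_n(j)^R$. A translate of $(t_i)$ is $(t_i+\lambda)$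 for nonzero $\lambda\in\mathbb{Z}_q$; a shift is $(t_{i+k})$. $D$ maps $(t_i)$ to $(t_{i+1}-t_i)$, and $D^{ -1}(S)$ is the set of all periodic sequences $T$ with $D(T)=S$. -}

module Defs where

open import Data.Nat using (ℕ; zero; suc; _+_; _*_; _∸_; _≤_; _<_; NonZero)
open import Data.Nat.DivMod using (_mod_; _%_)
open import Data.Fin using (Fin; toℕ)
open import Data.Vec using (Vec; tabulate; reverse; map)
open import Data.List using (upTo)
open import Data.Nat.ListAction using (sum)
import Data.List as List
open import Data.Product using (Σ; ∃; _×_)
open import Data.Sum using (_⊎_)
open import Relation.Binary.PropositionalEquality using (_≡_; _≢_)

-- ℤ_q is represented by Fin q (residues 0..q-1) with arithmetic mod q.
module _ (q : ℕ) .{{_ : NonZero q}} where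

  _+q_ : Fin q → Fin q → Fin q
  a +q b = (toℕ a + toℕ b) mod q

  -q_ : Fin q → Fin q
  -q a = (q ∸ toℕ a) mod q

  _-q_ : Fin q → Fin q → Fin q
  a -q b = (toℕ a + (q ∸ toℕ b)) mod q

-- A sequence over ℤ_q, indexed by ℕ (periodic sequences are determined
-- by any half-infinite tail).
Seq : ℕ → Set
Seq q = ℕ → Fin q

module _ {q : ℕ} where

  IsPeriod : Seq q → ℕ → Set
  IsPeriod s m = (1 ≤ m) × (∀ i → s (i + m) ≡ s i)

  HasPeriod : Seq q → ℕ → Set
  HasPeriod s m = IsPeriod s m × (∀ m' → IsPeriod s m' → m ≤ m')

  Periodic : Seq q → Set
  Periodic s = ∃ λ m → IsPeriod s m

  window : (n : ℕ) → Seq q → ℕ → Vec (Fin q) n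
  window n s i = tabulate (λ j → s (i + toℕ j))

CongMod : ℕ → ℕ → ℕ → Set
CongMod m i j = ∃ λ k → (i ≡ j + k * m) ⊎ (j ≡ i + k * m)

module _ (q : ℕ) .{{_ : NonZero q}} where

  negVec : {n : ℕ} → Vec (Fin q) n → Vec (Fin q) n
  negVec = map (-q_ q)

  IsWindowSeq : ℕ → Seq q → ℕ → Set
  IsWindowSeq n s m = ∀ i j → window n s i ≡ window n s j → CongMod m i j

  IsSpecialOrientable : ℕ → Seq q → ℕ → Set
  IsSpecialOrientable n s m =
    IsWindowSeq n s m ×
    (∀ i j → (window n s i ≢ reverse (window n s j)) ×
             (window n s i ≢ negVec (reverse (window n s j))))

  SpecialODisjoint : ℕ → Seq q → Seq q → Set
  SpecialODisjoint n s s' =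
    ∀ i j → (window n s i ≢ window n s' j) ×
            (window n s i ≢ reverse (window n s' j)) ×
            (window n s i ≢ negVec (reverse (window n s' j)))

  wq : Seq q → ℕ → Fin q
  wq s m = sum (List.map (λ i → toℕ (s i)) (upTo m)) mod q

  IsAddOrder : Fin q → ℕ → Set
  IsAddOrder w h = (1 ≤ h) × ((h * toℕ w) % q ≡ 0) ×
                   (∀ h' → 1 ≤ h' → (h' * toℕ w) % q ≡ 0 → h ≤ h')

  IsTranslate : Seq q → Seq q → Set
  IsTranslate T' T = Σ (Fin q) λ c → (toℕ c ≢ 0) × (∀ i → T' i ≡ _+q_ q (T i) c)

  D : Seq q → Seq q
  D t i = _-q_ q (t (suc i)) (t i)

  InDInv : Seq q → Seq q → Set
  InDInv s T = Periodic T × (∀ i → D T i ≡ s i)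

{-# OPTIONS --safe #-}
-- Write w = w_q(S) and P(i) = s₀ + ⋯ + s_{i-1}. The elements of D⁻¹(S) are the sequences
-- c + P(i) with c ∈ ℤ_q, and since P(i + m) = P(i) + w, shifting one of them by m adds w to c.
-- So each has period hm, and its shifts by multiples of m are its translates by the subgroup
-- ⟨w⟩ = (q/h)ℤ_q, whose cosets are represented by 0 ≤ ℓ < q/h. Applying D to a window of
-- length n + 1 of such a sequence gives a window of length n of S, and D turns reversal into
-- negated reversal and negated reversal into reversal, so the window and orientability
-- properties of S lift to each of these sequences.
module Submission where

open import Defs
open import Data.Nat
  using (ℕ; zero; suc; pred; _+_; _*_; _∸_; _≤_; _<_; NonZero; z≤n; s≤s; >-nonZero; >-nonZero⁻¹; ≢-nonZero)
open import Data.Nat.Properties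
open import Data.Nat.DivMod
  using (_%_; _/_; _mod_; m≡m%n+[m/n]*n; m%n<n; m%n%n≡m%n; m*n%n≡0; n%n≡0; m<n⇒m%n≡m;
         %-distribˡ-+; %-distribˡ-*; %-remove-+ʳ; m/n*n≡m; m∣n⇒o%n%m≡o%m)
open import Data.Nat.Divisibility using (_∣_; divides; m%n≡0⇒n∣m; *-cancelˡ-∣; ∣⇒≤; n∣m*n; ∣-trans)
open import Data.Nat.GCD using (gcd; gcd[m,n]∣m; gcd[m,n]∣n; gcd-GCD; module Bézout)
open import Data.Nat.ListAction using (sum)
open import Data.Nat.ListAction.Properties using (sum-++)
open import Data.Nat.Tactic.RingSolver using (solve-∀)
open import Algebra.Properties.CommutativeSemigroup +-commutativeSemigroup
  using () renaming (xy∙z≈xz∙y to +-xy∙z≈xz∙y; xy∙z≈yz∙x to +-xy∙z≈yz∙x;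
                     x∙yz≈y∙zx to +-x∙yz≈y∙zx; x∙yz≈xz∙y to +-x∙yz≈xz∙y)
open import Algebra.Properties.CommutativeSemigroup *-commutativeSemigroup
  using () renaming (xy∙z≈xz∙y to *-xy∙z≈xz∙y; x∙yz≈y∙xz to *-x∙yz≈y∙xz)
open import Data.Fin using (Fin; toℕ; inject₁; inject≤)
import Data.Fin as Fin
open import Data.Fin.Properties using (toℕ-injective; toℕ<n; toℕ-fromℕ<; toℕ-inject₁; toℕ-inject≤)
open import Data.Vec using (tabulate; reverse; lookup; _∷_; _∷ʳ_)
open import Data.Vec.Properties using (tabulate-cong; lookup∘tabulate; tabulate-∘; reverse-∷)
open import Data.List using (upTo; [_])
open import Data.List.Properties using (applyUpTo-∷ʳ; map-++)
import Data.List as List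
open import Data.Product using (Σ; ∃; _×_; _,_; proj₁; proj₂; map; map₂)
open import Data.Sum using (inj₁; inj₂)
open import Function using (_∘_; _⇔_; mk⇔)
open import Level using (0ℓ)
open import Relation.Binary.Bundles using (Setoid)
import Relation.Binary.Construct.On as On
import Relation.Binary.Reasoning.Setoid as SetoidReasoning
open import Relation.Binary.PropositionalEquality hiding ([_])
open import Relation.Nullary using (contradiction)

module Modular (q : ℕ) .{{_ : NonZero q}} where

  infix 4 _≈_
  _≈_ : ℕ → ℕ → Set
  a ≈ b = a % q ≡ b % q

  ≈-setoid : Setoid 0ℓ 0ℓ
  ≈-setoid = On.setoid (setoid ℕ) (_% q)

  open Setoid ≈-setoid public using () renaming (refl to ≈-refl; sym to ≈-sym; trans to ≈-trans)
  module ≈-Reasoning = SetoidReasoning ≈-setoid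

  0%q≡0 : 0 % q ≡ 0
  0%q≡0 = m<n⇒m%n≡m (>-nonZero⁻¹ q)

  q≈0 : q ≈ 0
  q≈0 = trans (n%n≡0 q) (sym 0%q≡0)

  *-q≈0 : ∀ k → k * q ≈ 0
  *-q≈0 k = trans (m*n%n≡0 k q) (sym 0%q≡0)

  +-cong : ∀ {a b c d} → a ≈ b → c ≈ d → a + c ≈ b + d
  +-cong {a} {b} {c} {d} a≈b c≈d = begin
    (a + c) % q          ≡⟨ %-distribˡ-+ a c q ⟩
    (a % q + c % q) % q  ≡⟨ cong₂ (λ x y → (x + y) % q) a≈b c≈d ⟩
    (b % q + d % q) % q  ≡⟨ %-distribˡ-+ b d q ⟨
    (b + d) % q          ∎
    where open ≡-Reasoning

  +-congˡ : ∀ a {b c} → b ≈ c → a + b ≈ a + c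
  +-congˡ a = +-cong {a} {a} refl

  *-congˡ : ∀ k {a b} → a ≈ b → k * a ≈ k * b
  *-congˡ k {a} {b} a≈b = begin
    (k * a) % q              ≡⟨ %-distribˡ-* k a q ⟩
    (k % q * (a % q)) % q    ≡⟨ cong (λ x → (k % q * x) % q) a≈b ⟩
    (k % q * (b % q)) % q    ≡⟨ %-distribˡ-* k b q ⟨
    (k * b) % q              ∎
    where open ≡-Reasoning

  pred-q-inverse : ∀ a → pred q * a + a ≈ 0
  pred-q-inverse a = begin
    pred q * a + a    ≡⟨ +-comm (pred q * a) a ⟩
    suc (pred q) * a  ≡⟨ cong (_* a) (suc-pred q) ⟩
    q * a             ≡⟨ *-comm q a ⟩
    a * q             ≈⟨ *-q≈0 a ⟩
    0                 ∎
    where open ≈-Reasoning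

  +-cancelʳ : ∀ c {a b} → a + c ≈ b + c → a ≈ b
  +-cancelʳ c {a} {b} a+c≈b+c = begin
    a                         ≡⟨ +-identityʳ a ⟨
    a + 0                     ≈⟨ +-congˡ a (pred-q-inverse c) ⟨
    a + (pred q * c + c)      ≡⟨ +-x∙yz≈xz∙y a (pred q * c) c ⟩
    a + c + pred q * c        ≈⟨ +-cong a+c≈b+c ≈-refl ⟩
    b + c + pred q * c        ≡⟨ +-x∙yz≈xz∙y b (pred q * c) c ⟨
    b + (pred q * c + c)      ≈⟨ +-congˡ b (pred-q-inverse c) ⟩
    b + 0                     ≡⟨ +-identityʳ b ⟩
    b                         ∎
    where open ≈-Reasoning

  bezout-≈ : ∀ {d a} → Bézout.Identity d a q → ∃ λ x → x * a ≈ d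
  bezout-≈ {d} {a} (Bézout.+- x y d+yq≡xa) = x , (begin
    x * a      ≡⟨ d+yq≡xa ⟨
    d + y * q  ≈⟨ +-congˡ d (*-q≈0 y) ⟩
    d + 0      ≡⟨ +-identityʳ d ⟩
    d          ∎)
    where open ≈-Reasoning
  bezout-≈ {d} {a} (Bézout.-+ x y d+xa≡yq) = pred q * x , +-cancelʳ (x * a) (begin
    pred q * x * a + x * a    ≡⟨ cong (_+ x * a) (*-assoc (pred q) x a) ⟩
    pred q * (x * a) + x * a  ≈⟨ pred-q-inverse (x * a) ⟩
    0                         ≈⟨ *-q≈0 y ⟨
    y * q                     ≡⟨ d+xa≡yq ⟨
    d + x * a                 ∎)
    where open ≈-Reasoning

  toℕ-mod : ∀ a → toℕ (a mod q) ≈ a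
  toℕ-mod a = trans (cong (_% q) (toℕ-fromℕ< (m%n<n a q))) (m%n%n≡m%n a q)

  toℕ-≈-injective : ∀ {x y : Fin q} → toℕ x ≈ toℕ y → x ≡ y
  toℕ-≈-injective {x} {y} x≈y = toℕ-injective (begin
    toℕ x      ≡⟨ m<n⇒m%n≡m (toℕ<n x) ⟨
    toℕ x % q  ≡⟨ x≈y ⟩
    toℕ y % q  ≡⟨ m<n⇒m%n≡m (toℕ<n y) ⟩
    toℕ y      ∎)
    where open ≡-Reasoning

  mod-cong : ∀ {a b} → a ≈ b → a mod q ≡ b mod q
  mod-cong {a} {b} a≈b = toℕ-≈-injective (≈-trans (toℕ-mod a) (≈-trans a≈b (≈-sym (toℕ-mod b))))

  +q-≈ : ∀ a b → toℕ (_+q_ q a b) ≈ toℕ a + toℕ b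
  +q-≈ a b = toℕ-mod (toℕ a + toℕ b)

  -q-≈ : ∀ a b → toℕ (_-q_ q a b) + toℕ b ≈ toℕ a
  -q-≈ a b = begin
    toℕ (_-q_ q a b) + toℕ b       ≈⟨ +-cong (toℕ-mod (toℕ a + (q ∸ toℕ b))) ≈-refl ⟩
    toℕ a + (q ∸ toℕ b) + toℕ b    ≡⟨ +-assoc (toℕ a) (q ∸ toℕ b) (toℕ b) ⟩
    toℕ a + (q ∸ toℕ b + toℕ b)    ≡⟨ cong (toℕ a +_) (m∸n+n≡m (<⇒≤ (toℕ<n b))) ⟩
    toℕ a + q                      ≈⟨ +-congˡ (toℕ a) q≈0 ⟩
    toℕ a + 0                      ≡⟨ +-identityʳ (toℕ a) ⟩
    toℕ a                          ∎
    where open ≈-Reasoning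

  neg-≈ : ∀ a → toℕ (-q_ q a) + toℕ a ≈ 0
  neg-≈ a = begin
    toℕ (-q_ q a) + toℕ a  ≈⟨ +-cong (toℕ-mod (q ∸ toℕ a)) ≈-refl ⟩
    q ∸ toℕ a + toℕ a      ≡⟨ m∸n+n≡m (<⇒≤ (toℕ<n a)) ⟩
    q                      ≈⟨ q≈0 ⟩
    0                      ∎
    where open ≈-Reasoning

  -q-unique : ∀ {x a b} → toℕ x + toℕ b ≈ toℕ a → x ≡ _-q_ q a b
  -q-unique {x} {a} {b} x+b≈a =
    toℕ-≈-injective (+-cancelʳ (toℕ b) (≈-trans x+b≈a (≈-sym (-q-≈ a b))))

  -q-cancelʳ : ∀ {a b c} → _-q_ q a c ≡ _-q_ q b c → a ≡ b
  -q-cancelʳ {a} {b} {c} eq = toℕ-≈-injective (begin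
    toℕ a                     ≈⟨ -q-≈ a c ⟨
    toℕ (_-q_ q a c) + toℕ c  ≡⟨ cong (λ x → toℕ x + toℕ c) eq ⟩
    toℕ (_-q_ q b c) + toℕ c  ≈⟨ -q-≈ b c ⟩
    toℕ b                     ∎)
    where open ≈-Reasoning

  -q-anticomm : ∀ a b → _-q_ q a b ≡ -q_ q (_-q_ q b a)
  -q-anticomm a b = sym (-q-unique (begin
    toℕ (-q_ q y) + toℕ b              ≈⟨ +-congˡ (toℕ (-q_ q y)) (-q-≈ b a) ⟨
    toℕ (-q_ q y) + (toℕ y + toℕ a)    ≡⟨ +-assoc (toℕ (-q_ q y)) (toℕ y) (toℕ a) ⟨
    toℕ (-q_ q y) + toℕ y + toℕ a      ≈⟨ +-cong (neg-≈ y) ≈-refl ⟩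
    toℕ a                              ∎))
    where
    open ≈-Reasoning
    y = _-q_ q b a

  -q-neg : ∀ a b → _-q_ q (-q_ q a) (-q_ q b) ≡ _-q_ q b a
  -q-neg a b = sym (-q-unique (begin
    z + nb               ≡⟨ +-identityʳ (z + nb) ⟨
    z + nb + 0           ≈⟨ +-congˡ (z + nb) (neg-≈ a) ⟨
    z + nb + (na + ta)   ≡⟨ rearrange z nb na ta ⟩
    na + (nb + (z + ta)) ≈⟨ +-congˡ na (+-congˡ nb (-q-≈ b a)) ⟩
    na + (nb + toℕ b)    ≈⟨ +-congˡ na (neg-≈ b) ⟩
    na + 0               ≡⟨ +-identityʳ na ⟩
    na                   ∎))
    where
    open ≈-Reasoning
    z = toℕ (_-q_ q b a)
    na = toℕ (-q_ q a)
    nb = toℕ (-q_ q b)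
    ta = toℕ a
    rearrange : ∀ z nb na ta → z + nb + (na + ta) ≡ na + (nb + (z + ta))
    rearrange = solve-∀

module _ {A : Set} where

  tabulate-∷ʳ : ∀ N (f : ℕ → A) →
                tabulate {n = suc N} (f ∘ toℕ) ≡ tabulate {n = N} (f ∘ toℕ) ∷ʳ f N
  tabulate-∷ʳ zero    f = refl
  tabulate-∷ʳ (suc N) f = cong (f 0 ∷_) (tabulate-∷ʳ N (f ∘ suc))

  reverse-tabulate : ∀ N (f : ℕ → A) →
                     reverse (tabulate {n = N} (f ∘ toℕ)) ≡ tabulate (λ j → f (N ∸ suc (toℕ j)))
  reverse-tabulate zero    f = refl
  reverse-tabulate (suc N) f = begin
    reverse (f 0 ∷ tabulate (f ∘ suc ∘ toℕ))           ≡⟨ reverse-∷ (f 0) (tabulate (f ∘ suc ∘ toℕ)) ⟩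
    reverse (tabulate (f ∘ suc ∘ toℕ)) ∷ʳ f 0           ≡⟨ cong (_∷ʳ f 0) (reverse-tabulate N (f ∘ suc)) ⟩
    tabulate (λ j → f (suc (N ∸ suc (toℕ j)))) ∷ʳ f 0   ≡⟨ cong₂ _∷ʳ_ (tabulate-cong λ j → cong f (+-∸-assoc 1 (toℕ<n j)))
                                                                     (cong f (n∸n≡0 N)) ⟨
    tabulate (λ j → f (N ∸ toℕ j)) ∷ʳ f (N ∸ N)         ≡⟨ tabulate-∷ʳ N (λ x → f (N ∸ x)) ⟨
    tabulate (λ j → f (N ∸ toℕ j))                      ∎
    where open ≡-Reasoning

periodic-* : ∀ {q} {t : Seq q} {m} → (∀ i → t (i + m) ≡ t i) → ∀ k i → t (i + k * m) ≡ t i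
periodic-* {t = t} per zero    i = cong t (+-identityʳ i)
periodic-* {t = t} {m} per (suc k) i = begin
  t (i + (m + k * m))  ≡⟨ cong t (+-assoc i m (k * m)) ⟨
  t (i + m + k * m)    ≡⟨ periodic-* per k (i + m) ⟩
  t (i + m)            ≡⟨ per i ⟩
  t i                  ∎
  where open ≡-Reasoning

least-period-∣ : ∀ {q} {t : Seq q} {m p} → HasPeriod t m → (∀ i → t (i + p) ≡ t i) → m ∣ p
least-period-∣ {t = t} {m@(suc _)} {p} ((_ , per) , least) per-p with p % m in eq
... | zero  = m%n≡0⇒n∣m p m eq
... | suc b = contradiction (least (suc b) (s≤s z≤n , per-b))
                            (<⇒≱ (subst (_< m) eq (m%n<n p m)))
  where
  open ≡-Reasoning
  per-b : ∀ i → t (i + suc b) ≡ t i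
  per-b i = begin
    t (i + suc b)                ≡⟨ periodic-* per (p / m) (i + suc b) ⟨
    t (i + suc b + p / m * m)    ≡⟨ cong t (+-assoc i (suc b) (p / m * m)) ⟩
    t (i + (suc b + p / m * m))  ≡⟨ cong (λ r → t (i + (r + p / m * m))) eq ⟨
    t (i + (p % m + p / m * m))  ≡⟨ cong (λ x → t (i + x)) (m≡m%n+[m/n]*n p m) ⟨
    t (i + p)                    ≡⟨ per-p i ⟩
    t i                          ∎

module Differences (q : ℕ) .{{_ : NonZero q}} where
  open Modular q using (-q-cancelʳ)

  D-periodic : ∀ {T : Seq q} {p} → (∀ i → T (i + p) ≡ T i) → ∀ i → D q T (i + p) ≡ D q T i
  D-periodic per i = cong₂ (_-q_ q) (per (suc i)) (per i)

  D-determined : ∀ (t u : Seq q) → (∀ i → D q t i ≡ D q u i) → t 0 ≡ u 0 → ∀ i → t i ≡ u i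
  D-determined t u Dt≡Du t0≡u0 zero    = t0≡u0
  D-determined t u Dt≡Du t0≡u0 (suc i) = -q-cancelʳ {c = u i}
    (trans (cong (_-q_ q (t (suc i))) (sym (D-determined t u Dt≡Du t0≡u0 i))) (Dt≡Du i))


module Windows (q : ℕ) .{{_ : NonZero q}} where
  open Modular q using (-q-anticomm; -q-neg)

  window-pointwise : ∀ {N} (t u : Seq q) i j → window N t i ≡ window N u j →
                     ∀ x → t (i + toℕ x) ≡ u (j + toℕ x)
  window-pointwise {N} t u i j eq x = begin
    t (i + toℕ x)            ≡⟨ lookup∘tabulate _ x ⟨
    lookup (window N t i) x  ≡⟨ cong (λ v → lookup v x) eq ⟩
    lookup (window N u j) x  ≡⟨ lookup∘tabulate _ x ⟩
    u (j + toℕ x)            ∎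
    where open ≡-Reasoning

  window-cong : ∀ {N} (t u : Seq q) i j → (∀ x → t (i + toℕ x) ≡ u (j + toℕ x)) →
                window N t i ≡ window N u j
  window-cong _ _ _ _ = tabulate-cong

  reverse-window : ∀ N (t : Seq q) i →
                   reverse (window N t i) ≡ window N (λ x → t (i + (N ∸ suc x))) 0
  reverse-window N t i = reverse-tabulate N (λ x → t (i + x))

  negVec-window : ∀ N (t : Seq q) i → negVec q (window N t i) ≡ window N (λ x → -q_ q (t x)) i
  negVec-window N t i = sym (tabulate-∘ (-q_ q) _)

  window-D : ∀ {N} (T U : Seq q) i j → window (suc N) T i ≡ window (suc N) U j →
             window N (D q T) i ≡ window N (D q U) j
  window-D T U i j eq = window-cong (D q T) (D q U) i j λ x → cong₂ (_-q_ q) (next x) (here x)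
    where
    at = window-pointwise T U i j eq
    next : ∀ x → T (suc (i + toℕ x)) ≡ U (suc (j + toℕ x))
    next x = subst₂ (λ a b → T a ≡ U b) (+-suc i (toℕ x)) (+-suc j (toℕ x)) (at (Fin.suc x))
    here : ∀ x → T (i + toℕ x) ≡ U (j + toℕ x)
    here x = subst (λ a → T (i + a) ≡ U (j + a)) (toℕ-inject₁ x) (at (inject₁ x))

  reflect-suc : ∀ {N} j x → x < N → j + (N ∸ x) ≡ suc (j + (N ∸ suc x))
  reflect-suc j x x<N = trans (cong (j +_) (+-∸-assoc 1 x<N)) (+-suc j _)

  window-D-reverse : ∀ {N} (T U : Seq q) i j → window (suc N) T i ≡ reverse (window (suc N) U j) →
                     window N (D q T) i ≡ negVec q (reverse (window N (D q U) j))
  window-D-reverse {N} T U i j eq = begin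
    window N (D q T) i                        ≡⟨ window-D T R i 0 (trans eq (reverse-window (suc N) U j)) ⟩
    window N (D q R) 0                        ≡⟨ window-cong (D q R) (-q_ q ∘ DU) 0 0 (λ x → D-R (toℕ x) (toℕ<n x)) ⟩
    window N (-q_ q ∘ DU) 0                   ≡⟨ negVec-window N DU 0 ⟨
    negVec q (window N DU 0)                  ≡⟨ cong (negVec q) (reverse-window N (D q U) j) ⟨
    negVec q (reverse (window N (D q U) j))   ∎
    where
    open ≡-Reasoning
    R DU : Seq q
    R x = U (j + (N ∸ x))
    DU x = D q U (j + (N ∸ suc x))
    D-R : ∀ x → x < N → D q R x ≡ -q_ q (DU x)
    D-R x x<N = begin
      _-q_ q (U (j + c)) (U (j + (N ∸ x)))   ≡⟨ cong (_-q_ q (U (j + c)) ∘ U) (reflect-suc j x x<N) ⟩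
      _-q_ q (U (j + c)) (U (suc (j + c)))   ≡⟨ -q-anticomm (U (j + c)) (U (suc (j + c))) ⟩
      -q_ q (DU x)                           ∎
      where c = N ∸ suc x

  window-D-negReverse : ∀ {N} (T U : Seq q) i j →
                        window (suc N) T i ≡ negVec q (reverse (window (suc N) U j)) →
                        window N (D q T) i ≡ reverse (window N (D q U) j)
  window-D-negReverse {N} T U i j eq = begin
    window N (D q T) i             ≡⟨ window-D T R i 0 (trans eq R-window) ⟩
    window N (D q R) 0             ≡⟨ window-cong (D q R) DU 0 0 (λ x → D-R (toℕ x) (toℕ<n x)) ⟩
    window N DU 0                  ≡⟨ reverse-window N (D q U) j ⟨
    reverse (window N (D q U) j)   ∎
    where
    open ≡-Reasoning
    R DU : Seq q
    R x = -q_ q (U (j + (N ∸ x)))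
    DU x = D q U (j + (N ∸ suc x))
    R-window : negVec q (reverse (window (suc N) U j)) ≡ window (suc N) R 0
    R-window = trans (cong (negVec q) (reverse-window (suc N) U j))
                     (negVec-window (suc N) (λ x → U (j + (N ∸ x))) 0)
    D-R : ∀ x → x < N → D q R x ≡ DU x
    D-R x x<N = begin
      _-q_ q (-q_ q (U (j + c))) (-q_ q (U (j + (N ∸ x))))     ≡⟨ cong (_-q_ q (-q_ q (U (j + c))) ∘ -q_ q ∘ U)
                                                                        (reflect-suc j x x<N) ⟩
      _-q_ q (-q_ q (U (j + c))) (-q_ q (U (suc (j + c))))     ≡⟨ -q-neg (U (j + c)) (U (suc (j + c))) ⟩
      DU x                                                     ∎
      where c = N ∸ suc x

module Integration (q : ℕ) .{{_ : NonZero q}} (s : Seq q) where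
  open Modular q
  open Differences q using (D-determined)

  partialSum : ℕ → ℕ
  partialSum zero    = 0
  partialSum (suc i) = partialSum i + toℕ (s i)

  sum-upTo : ∀ i → sum (List.map (toℕ ∘ s) (upTo i)) ≡ partialSum i
  sum-upTo zero    = refl
  sum-upTo (suc i) = begin
    sum (List.map f (upTo (suc i)))           ≡⟨ cong (sum ∘ List.map f) (applyUpTo-∷ʳ (λ x → x) i) ⟨
    sum (List.map f (upTo i List.++ [ i ]))   ≡⟨ cong sum (map-++ f (upTo i) [ i ]) ⟩
    sum (List.map f (upTo i) List.++ [ f i ]) ≡⟨ sum-++ (List.map f (upTo i)) [ f i ] ⟩
    sum (List.map f (upTo i)) + (f i + 0)     ≡⟨ cong₂ _+_ (sum-upTo i) (+-identityʳ (f i)) ⟩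
    partialSum i + f i                        ∎
    where
    open ≡-Reasoning
    f = toℕ ∘ s

  wq≈partialSum : ∀ m → toℕ (wq q s m) ≈ partialSum m
  wq≈partialSum m = ≈-trans (toℕ-mod _) (cong (_% q) (sum-upTo m))

  module _ {m} (per : ∀ i → s (i + m) ≡ s i) where

    partialSum-+-period : ∀ i → partialSum (i + m) ≡ partialSum i + partialSum m
    partialSum-+-period zero    = refl
    partialSum-+-period (suc i) = begin
      partialSum (i + m) + toℕ (s (i + m))      ≡⟨ cong₂ _+_ (partialSum-+-period i) (cong toℕ (per i)) ⟩
      partialSum i + partialSum m + toℕ (s i)   ≡⟨ +-xy∙z≈xz∙y (partialSum i) (partialSum m) (toℕ (s i)) ⟩
      partialSum i + toℕ (s i) + partialSum m   ∎
      where open ≡-Reasoning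

    partialSum-+-periods : ∀ k i → partialSum (i + k * m) ≡ partialSum i + k * partialSum m
    partialSum-+-periods zero    i =
      trans (cong partialSum (+-identityʳ i)) (sym (+-identityʳ (partialSum i)))
    partialSum-+-periods (suc k) i = begin
      partialSum (i + (m + k * m))                     ≡⟨ cong partialSum (+-assoc i m (k * m)) ⟨
      partialSum (i + m + k * m)                       ≡⟨ partialSum-+-periods k (i + m) ⟩
      partialSum (i + m) + k * partialSum m            ≡⟨ cong (_+ k * partialSum m) (partialSum-+-period i) ⟩
      partialSum i + partialSum m + k * partialSum m   ≡⟨ +-assoc (partialSum i) (partialSum m) (k * partialSum m) ⟩
      partialSum i + (partialSum m + k * partialSum m) ∎
      where open ≡-Reasoning

  integral : ℕ → Seq q
  integral c i = (c + partialSum i) mod q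

  toℕ-integral : ∀ c i → toℕ (integral c i) ≈ c + partialSum i
  toℕ-integral c i = toℕ-mod (c + partialSum i)

  D-integral : ∀ c i → D q (integral c) i ≡ s i
  D-integral c i = sym (-q-unique (begin
    toℕ (s i) + toℕ (integral c i)    ≈⟨ +-congˡ (toℕ (s i)) (toℕ-integral c i) ⟩
    toℕ (s i) + (c + partialSum i)    ≡⟨ +-x∙yz≈y∙zx (toℕ (s i)) c (partialSum i) ⟩
    c + (partialSum i + toℕ (s i))    ≈⟨ toℕ-integral c (suc i) ⟨
    toℕ (integral c (suc i))          ∎))
    where open ≈-Reasoning

  integral-cong : ∀ c c' → c ≈ c' → ∀ i → integral c i ≡ integral c' i
  integral-cong c c' c≈c' i = mod-cong (+-cong c≈c' ≈-refl)

  integral-injective : ∀ c c' i → integral c i ≡ integral c' i → c ≈ c'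
  integral-injective c c' i eq = +-cancelʳ (partialSum i) (begin
    c + partialSum i          ≈⟨ toℕ-integral c i ⟨
    toℕ (integral c i)        ≡⟨ cong toℕ eq ⟩
    toℕ (integral c' i)       ≈⟨ toℕ-integral c' i ⟩
    c' + partialSum i         ∎)
    where open ≈-Reasoning

  integral-shift : ∀ {m} → (∀ i → s (i + m) ≡ s i) →
                   ∀ c k i → integral c (i + k * m) ≡ integral (c + k * partialSum m) i
  integral-shift {m} per c k i = cong (_mod q) (begin
    c + partialSum (i + k * m)             ≡⟨ cong (c +_) (partialSum-+-periods per k i) ⟩
    c + (partialSum i + k * partialSum m)  ≡⟨ +-x∙yz≈xz∙y c (partialSum i) (k * partialSum m) ⟩
    c + k * partialSum m + partialSum i    ∎)
    where open ≡-Reasoning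

  integral-translate : ∀ c c' d → toℕ d + c ≈ c' → ∀ i → integral c' i ≡ _+q_ q (integral c i) d
  integral-translate c c' d d+c≈c' i = toℕ-≈-injective (begin
    toℕ (integral c' i)                  ≈⟨ toℕ-integral c' i ⟩
    c' + partialSum i                    ≈⟨ +-cong d+c≈c' ≈-refl ⟨
    toℕ d + c + partialSum i             ≡⟨ +-xy∙z≈yz∙x (toℕ d) c (partialSum i) ⟩
    c + partialSum i + toℕ d             ≈⟨ +-cong (toℕ-integral c i) ≈-refl ⟨
    toℕ (integral c i) + toℕ d           ≈⟨ +q-≈ (integral c i) d ⟨
    toℕ (_+q_ q (integral c i) d)        ∎)
    where open ≈-Reasoning

  integral-toℕ-0 : ∀ x → integral (toℕ x) 0 ≡ x
  integral-toℕ-0 x =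
    toℕ-≈-injective (≈-trans (toℕ-integral (toℕ x) 0) (cong (_% q) (+-identityʳ (toℕ x))))

  D⁻¹-integral : ∀ (t : Seq q) → (∀ i → D q t i ≡ s i) → ∀ i → t i ≡ integral (toℕ (t 0)) i
  D⁻¹-integral t Dt≡s = D-determined t (integral (toℕ (t 0)))
    (λ i → trans (Dt≡s i) (sym (D-integral (toℕ (t 0)) i))) (sym (integral-toℕ-0 (t 0)))

module AdditiveOrder (q : ℕ) .{{_ : NonZero q}} (w : Fin q) (h : ℕ) (order : IsAddOrder q w h) where
  open Modular q

  instance
    order≢0 : NonZero h
    order≢0 = >-nonZero (proj₁ order)

  order-annihilates : h * toℕ w ≈ 0
  order-annihilates = trans (proj₁ (proj₂ order)) (sym 0%q≡0)

  ∣⇒annihilates : ∀ {k} → h ∣ k → k * toℕ w ≈ 0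
  ∣⇒annihilates (divides t refl) = begin
    t * h * toℕ w    ≡⟨ *-assoc t h (toℕ w) ⟩
    t * (h * toℕ w)  ≈⟨ *-congˡ t order-annihilates ⟩
    t * 0            ≡⟨ *-zeroʳ t ⟩
    0                ∎
    where open ≈-Reasoning

  *-reduce-order : ∀ k → k * toℕ w ≈ k % h * toℕ w
  *-reduce-order k = begin
    k * toℕ w                              ≡⟨ cong (_* toℕ w) (m≡m%n+[m/n]*n k h) ⟩
    (k % h + k / h * h) * toℕ w            ≡⟨ *-distribʳ-+ (toℕ w) (k % h) (k / h * h) ⟩
    k % h * toℕ w + k / h * h * toℕ w      ≈⟨ +-congˡ (k % h * toℕ w) (∣⇒annihilates (n∣m*n (k / h))) ⟩
    k % h * toℕ w + 0                      ≡⟨ +-identityʳ _ ⟩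
    k % h * toℕ w                          ∎
    where open ≈-Reasoning

  annihilates⇒∣ : ∀ {k} → k * toℕ w ≈ 0 → h ∣ k
  annihilates⇒∣ {k} kw≈0 with k % h in k%h≡
  ... | zero  = m%n≡0⇒n∣m k h k%h≡
  ... | suc b = contradiction (proj₂ (proj₂ order) (suc b) (s≤s z≤n) sb-annihilates)
                              (<⇒≱ (subst (_< h) k%h≡ (m%n<n k h)))
    where
    sb-annihilates : (suc b * toℕ w) % q ≡ 0
    sb-annihilates = begin
      (suc b * toℕ w) % q   ≡⟨ cong (λ r → (r * toℕ w) % q) k%h≡ ⟨
      (k % h * toℕ w) % q   ≡⟨ *-reduce-order k ⟨
      (k * toℕ w) % q       ≡⟨ kw≈0 ⟩
      0 % q                 ≡⟨ 0%q≡0 ⟩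
      0                     ∎
      where open ≡-Reasoning

  order∣q : h ∣ q
  order∣q = annihilates⇒∣ (trans (cong (_% q) (*-comm q (toℕ w))) (*-q≈0 (toℕ w)))

  index : ℕ
  index = q / h

  index*order≡q : index * h ≡ q
  index*order≡q = m/n*n≡m order∣q

  instance
    index≢0 : NonZero index
    index≢0 = ≢-nonZero λ index≡0 →
      <⇒≢ (>-nonZero⁻¹ q) (trans (cong (_* h) (sym index≡0)) index*order≡q)

  index≤q : index ≤ q
  index≤q = subst (index ≤_) index*order≡q (m≤m*n index h)

  index∣q : index ∣ q
  index∣q = divides h (trans (sym index*order≡q) (*-comm index h))

  index∣w : index ∣ toℕ w
  index∣w = *-cancelˡ-∣ h (subst (_∣ h * toℕ w) (trans (sym index*order≡q) (*-comm index h))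
                                 (m%n≡0⇒n∣m (h * toℕ w) q (proj₁ (proj₂ order))))

  gcd∣index : gcd (toℕ w) q ∣ index
  gcd∣index = divides t (*-cancelʳ-≡ index (t * g) h (begin
    index * h    ≡⟨ index*order≡q ⟩
    q            ≡⟨ q≡ug ⟩
    u * g        ≡⟨ cong (_* g) u≡th ⟩
    t * h * g    ≡⟨ *-xy∙z≈xz∙y t h g ⟩
    t * g * h    ∎))
    where
    open ≡-Reasoning
    g = gcd (toℕ w) q
    open _∣_ (gcd[m,n]∣n (toℕ w) q) renaming (quotient to u; equality to q≡ug)
    open _∣_ (gcd[m,n]∣m (toℕ w) q) renaming (quotient to v; equality to w≡vg)
    u-annihilates : u * toℕ w ≈ 0
    u-annihilates = ≈-trans (cong (_% q) (begin
      u * toℕ w    ≡⟨ cong (u *_) w≡vg ⟩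
      u * (v * g)  ≡⟨ *-x∙yz≈y∙xz u v g ⟩
      v * (u * g)  ≡⟨ cong (v *_) q≡ug ⟨
      v * q        ∎)) (*-q≈0 v)
    open _∣_ (annihilates⇒∣ {u} u-annihilates) renaming (quotient to t; equality to u≡th)

  index-multiple : ∃ λ x → x * toℕ w ≈ index
  index-multiple with gcd∣index | bezout-≈ (Bézout.identity (gcd-GCD (toℕ w) q))
  ... | divides t index≡tg | x , xw≈g = t * x , (begin
    t * x * toℕ w             ≡⟨ *-assoc t x (toℕ w) ⟩
    t * (x * toℕ w)           ≈⟨ *-congˡ t xw≈g ⟩
    t * gcd (toℕ w) q         ≡⟨ index≡tg ⟨
    index                     ∎)
    where open ≈-Reasoning

  decompose : ∀ c → ∃ λ (ℓ : Fin index) → ∃ λ k → k < h × c ≈ toℕ ℓ + k * toℕ w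
  decompose c = c mod index , k % h , m%n<n k h , (begin
    c                                        ≡⟨ m≡m%n+[m/n]*n c index ⟩
    c % index + c / index * index            ≈⟨ +-congˡ (c % index) (*-congˡ (c / index) (≈-sym (proj₂ index-multiple))) ⟩
    c % index + c / index * (x * toℕ w)      ≡⟨ cong (c % index +_) (*-assoc (c / index) x (toℕ w)) ⟨
    c % index + k * toℕ w                    ≈⟨ +-congˡ (c % index) (*-reduce-order k) ⟩
    c % index + k % h * toℕ w                ≡⟨ cong (_+ k % h * toℕ w) (toℕ-fromℕ< (m%n<n c index)) ⟨
    toℕ (c mod index) + k % h * toℕ w        ∎)
    where
    open ≈-Reasoning
    x = proj₁ index-multiple
    k = c / index * x

  coset-unique : ∀ (ℓ ℓ' : Fin index) k → toℕ ℓ + k * toℕ w ≈ toℕ ℓ' → ℓ ≡ ℓ'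
  coset-unique ℓ ℓ' k ℓ+kw≈ℓ' = toℕ-injective (begin
    toℕ ℓ                              ≡⟨ m<n⇒m%n≡m (toℕ<n ℓ) ⟨
    toℕ ℓ % index                      ≡⟨ %-remove-+ʳ (toℕ ℓ) (∣-trans index∣w (n∣m*n k)) ⟨
    (toℕ ℓ + k * toℕ w) % index        ≡⟨ m∣n⇒o%n%m≡o%m index q _ index∣q ⟨
    (toℕ ℓ + k * toℕ w) % q % index    ≡⟨ cong (_% index) ℓ+kw≈ℓ' ⟩
    toℕ ℓ' % q % index                 ≡⟨ m∣n⇒o%n%m≡o%m index q _ index∣q ⟩
    toℕ ℓ' % index                     ≡⟨ m<n⇒m%n≡m (toℕ<n ℓ') ⟩
    toℕ ℓ'                             ∎)
    where open ≡-Reasoning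

module Lifts (q : ℕ) .{{_ : NonZero q}} (s : Seq q) (m : ℕ) (s-period : HasPeriod s m)
             (h : ℕ) (order : IsAddOrder q (wq q s m) h) where
  open Modular q
  open Windows q
  open Differences q using (D-periodic)
  open Integration q s
  open AdditiveOrder q (wq q s m) h order public

  w : ℕ
  w = toℕ (wq q s m)

  s-periodic : ∀ i → s (i + m) ≡ s i
  s-periodic = proj₂ (proj₁ s-period)

  1≤h*m : 1 ≤ h * m
  1≤h*m = *-mono-≤ (proj₁ order) (proj₁ (proj₁ s-period))

  lift : Fin index → Seq q
  lift ℓ = integral (toℕ ℓ)

  lift-shift : ∀ ℓ k i → lift ℓ (i + k * m) ≡ integral (toℕ ℓ + k * w) i
  lift-shift ℓ k i = trans (integral-shift s-periodic (toℕ ℓ) k i)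
    (integral-cong (toℕ ℓ + k * partialSum m) (toℕ ℓ + k * w)
                   (+-congˡ (toℕ ℓ) (*-congˡ k (≈-sym (wq≈partialSum m)))) i)

  lift-period : ∀ ℓ i → lift ℓ (i + h * m) ≡ lift ℓ i
  lift-period ℓ i = trans (lift-shift ℓ h i) (integral-cong (toℕ ℓ + h * w) (toℕ ℓ) ℓ+hw≈ℓ i)
    where
    ℓ+hw≈ℓ : toℕ ℓ + h * w ≈ toℕ ℓ
    ℓ+hw≈ℓ = ≈-trans (+-congˡ (toℕ ℓ) order-annihilates) (cong (_% q) (+-identityʳ (toℕ ℓ)))

  lift-collision : ∀ ℓ ℓ' k j → lift ℓ (j + k * m) ≡ lift ℓ' j → ℓ ≡ ℓ' × h ∣ k
  lift-collision ℓ ℓ' k j eq = ℓ≡ℓ' , annihilates⇒∣ (+-cancelʳ (toℕ ℓ) (begin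
    k * w + toℕ ℓ    ≡⟨ +-comm (k * w) (toℕ ℓ) ⟩
    toℕ ℓ + k * w    ≈⟨ ℓ+kw≈ℓ' ⟩
    toℕ ℓ'           ≡⟨ cong toℕ ℓ≡ℓ' ⟨
    toℕ ℓ            ∎))
    where
    open ≈-Reasoning
    ℓ+kw≈ℓ' : toℕ ℓ + k * w ≈ toℕ ℓ'
    ℓ+kw≈ℓ' = integral-injective (toℕ ℓ + k * w) (toℕ ℓ') j (trans (sym (lift-shift ℓ k j)) eq)
    ℓ≡ℓ' : ℓ ≡ ℓ'
    ℓ≡ℓ' = coset-unique ℓ ℓ' k ℓ+kw≈ℓ'

  lift-hasPeriod : ∀ ℓ → HasPeriod (lift ℓ) (h * m)
  lift-hasPeriod ℓ = (1≤h*m , lift-period ℓ) , least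
    where
    least : ∀ p → IsPeriod (lift ℓ) p → h * m ≤ p
    least p (1≤p , per) with least-period-∣ s-period (λ i → trans (sym (D-integral (toℕ ℓ) (i + p)))
                                                          (trans (D-periodic per i) (D-integral (toℕ ℓ) i)))
    ... | divides zero    refl = contradiction 1≤p n≮0
    ... | divides (suc a) refl = *-monoˡ-≤ m (∣⇒≤ (proj₂ (lift-collision ℓ ℓ (suc a) 0 (per 0))))

  window-lift : ∀ {N} ℓ i → window N (D q (lift ℓ)) i ≡ window N s i
  window-lift ℓ i = window-cong (D q (lift ℓ)) s i i (λ x → D-integral (toℕ ℓ) (i + toℕ x))

  lift-windows : ∀ {n} ℓ ℓ' i j → window (suc n) (lift ℓ) i ≡ window (suc n) (lift ℓ') j →
                 lift ℓ i ≡ lift ℓ' j × window n s i ≡ window n s j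
  lift-windows {n} ℓ ℓ' i j eq = heads , (begin
    window n s i                 ≡⟨ window-lift ℓ i ⟨
    window n (D q (lift ℓ)) i    ≡⟨ window-D (lift ℓ) (lift ℓ') i j eq ⟩
    window n (D q (lift ℓ')) j   ≡⟨ window-lift ℓ' j ⟩
    window n s j                 ∎)
    where
    open ≡-Reasoning
    heads = subst₂ (λ a b → lift ℓ a ≡ lift ℓ' b) (+-identityʳ i) (+-identityʳ j)
                   (window-pointwise (lift ℓ) (lift ℓ') i j eq Fin.zero)

  shifted-lift-collision : ∀ ℓ ℓ' i j k → lift ℓ i ≡ lift ℓ' j → i ≡ j + k * m →
                           ℓ ≡ ℓ' × ∃ λ t → i ≡ j + t * (h * m)
  shifted-lift-collision ℓ ℓ' i j k eq i≡j+km
    with lift-collision ℓ ℓ' k j (subst (λ x → lift ℓ x ≡ lift ℓ' j) i≡j+km eq)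
  ... | ℓ≡ℓ' , divides t refl = ℓ≡ℓ' , t , trans i≡j+km (cong (j +_) (*-assoc t h m))

  lift-window-collision : ∀ {n} → IsWindowSeq q n s m → ∀ ℓ ℓ' i j →
                          window (suc n) (lift ℓ) i ≡ window (suc n) (lift ℓ') j →
                          ℓ ≡ ℓ' × CongMod (h * m) i j
  lift-window-collision s-window ℓ ℓ' i j eq with lift-windows ℓ ℓ' i j eq
  ... | heads , s-windows with s-window i j s-windows
  ...   | k , inj₁ i≡j+km = map₂ (map₂ inj₁) (shifted-lift-collision ℓ ℓ' i j k heads i≡j+km)
  ...   | k , inj₂ j≡i+km = map sym (map₂ inj₂) (shifted-lift-collision ℓ' ℓ j i k (sym heads) j≡i+km)

  lift-reverse : ∀ {n} ℓ ℓ' i j →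
                 window (suc n) (lift ℓ) i ≡ reverse (window (suc n) (lift ℓ') j) →
                 window n s i ≡ negVec q (reverse (window n s j))
  lift-reverse {n} ℓ ℓ' i j eq = begin
    window n s i                                     ≡⟨ window-lift ℓ i ⟨
    window n (D q (lift ℓ)) i                        ≡⟨ window-D-reverse (lift ℓ) (lift ℓ') i j eq ⟩
    negVec q (reverse (window n (D q (lift ℓ')) j))  ≡⟨ cong (negVec q ∘ reverse) (window-lift ℓ' j) ⟩
    negVec q (reverse (window n s j))                ∎
    where open ≡-Reasoning

  lift-negReverse : ∀ {n} ℓ ℓ' i j →
                    window (suc n) (lift ℓ) i ≡ negVec q (reverse (window (suc n) (lift ℓ') j)) →
                    window n s i ≡ reverse (window n s j)
  lift-negReverse {n} ℓ ℓ' i j eq = begin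
    window n s i                            ≡⟨ window-lift ℓ i ⟨
    window n (D q (lift ℓ)) i               ≡⟨ window-D-negReverse (lift ℓ) (lift ℓ') i j eq ⟩
    reverse (window n (D q (lift ℓ')) j)    ≡⟨ cong reverse (window-lift ℓ' j) ⟩
    reverse (window n s j)                  ∎
    where open ≡-Reasoning

  lifts-unreversed : ∀ {n} → IsSpecialOrientable q n s m → ∀ ℓ ℓ' i j →
                     (window (suc n) (lift ℓ) i ≢ reverse (window (suc n) (lift ℓ') j)) ×
                     (window (suc n) (lift ℓ) i ≢ negVec q (reverse (window (suc n) (lift ℓ') j)))
  lifts-unreversed (_ , s-unreversed) ℓ ℓ' i j =
    proj₂ (s-unreversed i j) ∘ lift-reverse ℓ ℓ' i j ,
    proj₁ (s-unreversed i j) ∘ lift-negReverse ℓ ℓ' i j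

  lift-specialOrientable : ∀ {n} → IsSpecialOrientable q n s m →
                           ∀ ℓ → IsSpecialOrientable q (suc n) (lift ℓ) (h * m)
  lift-specialOrientable s-so ℓ =
    (λ i j → proj₂ ∘ lift-window-collision (proj₁ s-so) ℓ ℓ i j) , lifts-unreversed s-so ℓ ℓ

  lifts-specialODisjoint : ∀ {n} → IsSpecialOrientable q n s m → ∀ {ℓ ℓ'} → ℓ ≢ ℓ' →
                           SpecialODisjoint q (suc n) (lift ℓ) (lift ℓ')
  lifts-specialODisjoint s-so {ℓ} {ℓ'} ℓ≢ℓ' i j =
    ℓ≢ℓ' ∘ proj₁ ∘ lift-window-collision (proj₁ s-so) ℓ ℓ' i j , lifts-unreversed s-so ℓ ℓ' i j

  lift-translate : ∀ {ℓ ℓ'} → ℓ ≢ ℓ' → IsTranslate q (lift ℓ') (lift ℓ)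
  lift-translate {ℓ} {ℓ'} ℓ≢ℓ' = d , d≢0 , integral-translate (toℕ ℓ) (toℕ ℓ') d d+ℓ≈ℓ'
    where
    ι : Fin index → Fin q
    ι x = inject≤ x index≤q
    d : Fin q
    d = _-q_ q (ι ℓ') (ι ℓ)
    d+ℓ≈ℓ' : toℕ d + toℕ ℓ ≈ toℕ ℓ'
    d+ℓ≈ℓ' = subst₂ (λ a b → toℕ d + a ≈ b) (toℕ-inject≤ ℓ index≤q) (toℕ-inject≤ ℓ' index≤q)
                    (-q-≈ (ι ℓ') (ι ℓ))
    d≢0 : toℕ d ≢ 0
    d≢0 d≡0 = ℓ≢ℓ' (coset-unique ℓ ℓ' 0
      (trans (cong (_% q) (+-identityʳ (toℕ ℓ))) (subst (λ x → x + toℕ ℓ ≈ toℕ ℓ') d≡0 d+ℓ≈ℓ')))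

  D⁻¹⊆shifted-lifts : ∀ T → (∀ i → D q T i ≡ s i) →
                      ∃ λ ℓ → Σ ℕ λ k → (k < h) × (∀ i → T i ≡ lift ℓ (i + k * m))
  D⁻¹⊆shifted-lifts T DT≡s =
    let ℓ , k , k<h , T0≈ℓ+kw = decompose (toℕ (T 0))
    in ℓ , k , k<h , λ i → begin
      T i                          ≡⟨ D⁻¹-integral T DT≡s i ⟩
      integral (toℕ (T 0)) i       ≡⟨ integral-cong (toℕ (T 0)) (toℕ ℓ + k * w) T0≈ℓ+kw i ⟩
      integral (toℕ ℓ + k * w) i   ≡⟨ lift-shift ℓ k i ⟨
      lift ℓ (i + k * m)           ∎
    where open ≡-Reasoning

  shifted-lift∈D⁻¹ : ∀ T ℓ k → (∀ i → T i ≡ lift ℓ (i + k * m)) → InDInv q s T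
  shifted-lift∈D⁻¹ T ℓ k T≡lift = (h * m , 1≤h*m , T-period) , DT≡s
    where
    open ≡-Reasoning
    T-period : ∀ i → T (i + h * m) ≡ T i
    T-period i = begin
      T (i + h * m)                ≡⟨ T≡lift (i + h * m) ⟩
      lift ℓ (i + h * m + k * m)   ≡⟨ cong (lift ℓ) (+-xy∙z≈xz∙y i (h * m) (k * m)) ⟩
      lift ℓ (i + k * m + h * m)   ≡⟨ lift-period ℓ (i + k * m) ⟩
      lift ℓ (i + k * m)           ≡⟨ T≡lift i ⟨
      T i                          ∎
    DT≡s : ∀ i → D q T i ≡ s i
    DT≡s i = begin
      D q T i                      ≡⟨ cong₂ (_-q_ q) (T≡lift (suc i)) (T≡lift i) ⟩
      D q (lift ℓ) (i + k * m)     ≡⟨ D-integral (toℕ ℓ) (i + k * m) ⟩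
      s (i + k * m)                ≡⟨ periodic-* s-periodic k i ⟩
      s i                          ∎

  D⁻¹-lifts : ∀ T → InDInv q s T ⇔ (∃ λ ℓ → Σ ℕ λ k → (k < h) × (∀ i → T i ≡ lift ℓ (i + k * m)))
  D⁻¹-lifts T = mk⇔ (D⁻¹⊆shifted-lifts T ∘ proj₂)
                    (λ (ℓ , k , _ , T≡lift) → shifted-lift∈D⁻¹ T ℓ k T≡lift)

theorem7 : (q : ℕ) .{{_ : NonZero q}} → 2 ≤ q → (n : ℕ) → 1 ≤ n →
             (s : Seq q) (m : ℕ) → HasPeriod s m → IsSpecialOrientable q n s m →
             (h : ℕ) → IsAddOrder q (wq q s m) h →
             Σ ℕ λ r → (r * h ≡ q) × Σ (Fin r → Seq q) λ T →
               (∀ ℓ → HasPeriod (T ℓ) (h * m) × IsSpecialOrientable q (suc n) (T ℓ) (h * m)) ×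
               (∀ ℓ ℓ' → ℓ ≢ ℓ' → IsTranslate q (T ℓ') (T ℓ)) ×
               (∀ ℓ ℓ' → ℓ ≢ ℓ' → SpecialODisjoint q (suc n) (T ℓ) (T ℓ')) ×
               (∀ (T' : Seq q) → InDInv q s T' ⇔
                  (∃ λ ℓ → Σ ℕ λ k → (k < h) × (∀ i → T' i ≡ T ℓ (i + k * m))))
theorem7 q _ n _ s m s-period s-so h order =
  index , index*order≡q , lift ,
  (λ ℓ → lift-hasPeriod ℓ , lift-specialOrientable s-so ℓ) ,
  (λ _ _ → lift-translate) ,
  (λ _ _ → lifts-specialODisjoint s-so) ,
  D⁻¹-lifts
  where open Lifts q s m s-period h order
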